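{- Let $f(x)=ax^2+bx+c$ be an irreducible quadratic polynomial in $\mathbb{Z}[x]$ with $a>0$, let $D=b^2-4ac$, $q=a/\gcd(a,b)$ and $l=b/\gcd(a,b)$. Let $r$ be an integer with $\gcd(r,q)=1$, and let $p$ be a prime with $p\nmid 2aD$, $(D/p)=1$ and $p\equiv l\,r^{ -1}\pmod q$ (where $r^{ -1}$ is the inverse of $r$ modulo $q$). Let $\nu_{p,1},\nu_{p,2}$ be the two solutions in $\{0,1,\dots,p-1\}$ of $f(x)\equiv 0\pmod p$. Then $$\frac{\nu_{p,1}}{p}+\frac{\nu_{p,2}}{p}\equiv \frac rq-\frac{l}{pq}\pmod 1.$$
   Context: $(D/p)$ is the Kronecker symbol (for such $p$, which is odd, the Legendre symbol); for such $p$ the congruence $f(x)\equiv0\pmod p$ has exactly two solutions modulo $p$. -}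

module Defs where

open import Data.Nat as ℕ using (ℕ)
open import Data.Integer using (ℤ; +_; -_; _+_; _-_; _*_; 0ℤ; 1ℤ; -1ℤ)
open import Data.Integer.Divisibility.Signed using (_∣_; _∣?_)
open import Data.Bool.ListAction using (any)
open import Data.List.Base using (upTo)
open import Data.Bool using (Bool; true; false; if_then_else_)
open import Data.Product using (∃; _×_)
open import Relation.Nullary using (¬_; Dec; yes; no)
open import Relation.Nullary.Decidable using (⌊_⌋)
open import Relation.Binary.PropositionalEquality using (_≡_; _≢_)

infix 4 _≡ℤ_[mod_]
_≡ℤ_[mod_] : ℤ → ℤ → ℤ → Set
x ≡ℤ y [mod m ] = m ∣ (x - y)

quadVal : ℤ → ℤ → ℤ → ℤ → ℤ
quadVal a b c x = a * x * x + b * x + c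

-- Irreducibility of f(x) = a x^2 + b x + c (with a ≠ 0) in ℤ[x], unfolded:
-- a factorisation f = g h into non-units has deg g + deg h = 2, so it is either
-- (constant non-unit d) * (quadratic), i.e. d ∉ {1,-1} divides all coefficients,
-- or (u x + v)(s x + t) with two linear factors (linear polynomials are never units).
IrreducibleQuadratic : ℤ → ℤ → ℤ → Set
IrreducibleQuadratic a b c =
  ¬ (∃ λ d → d ≢ 1ℤ × d ≢ -1ℤ × d ∣ a × d ∣ b × d ∣ c)
  × ¬ (∃ λ u → ∃ λ v → ∃ λ s → ∃ λ t →
         u * s ≡ a × u * t + v * s ≡ b × v * t ≡ c)

legendre : ℤ → ℕ → ℤ
legendre D p =
  if ⌊ + p ∣? D ⌋ then 0ℤ
  else (if any (λ x → ⌊ + p ∣? (+ x * + x - D) ⌋) (upTo p) then 1ℤ else -1ℤ)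

{-# OPTIONS --safe #-}
module Submission where

-- If ν₁ ≢ ν₂ are roots of f modulo p, then p divides
-- f(ν₁) − f(ν₂) = (ν₁ − ν₂)(a(ν₁ + ν₂) + b) but not ν₁ − ν₂, so p ∣ a(ν₁ + ν₂) + b.
-- Dividing by g = gcd(a, b), which is prime to p since p ∤ a, gives p ∣ q(ν₁ + ν₂) + l.
-- On the other hand p ≡ l r⁻¹ (mod q) gives q ∣ q(ν₁ + ν₂) + l − rp, and p ∤ q,
-- so pq divides q(ν₁ + ν₂) + l − rp, which is pq times ν₁/p + ν₂/p − (r/q − l/(pq)).

open import Defs
open import Data.Nat as ℕ using (ℕ; NonZero; suc)
open import Data.Nat.Properties using (m*n≢0; <-cmp; ≤-<-trans; m∸n≤m; m<n⇒0<n∸m)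
open import Data.Nat.Primality using (Prime; euclidsLemma)
import Data.Nat.Divisibility as ℕ
open import Data.Integer as ℤ using (ℤ; +_; _*_; _-_; _⊖_; 0ℤ; 1ℤ)
open import Data.Integer.Properties using (abs-*; m-n≡m⊖n; ∣⊖∣-<; ∣m⊖n∣≡∣n⊖m∣; *-comm; *-identityʳ; pos-*)
open import Data.Integer.GCD using (gcd)
open import Data.Integer.Divisibility.Signed
  using (_∣_; divides; ∣-refl; ∣⇒∣ᵤ; ∣ᵤ⇒∣; ∣m∣n⇒∣m+n; ∣m∣n⇒∣m-n; ∣m⇒∣m*n; ∣n⇒∣m*n; *-monoˡ-∣)
open import Data.Integer.Coprimality using (Coprime)
open import Data.Integer.Tactic.RingSolver using (solve-∀)
open import Data.Rational as ℚ using (_/_; toℚᵘ)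
open import Data.Rational.Properties using (toℚᵘ-injective; toℚᵘ-fromℚᵘ; toℚᵘ-homo-+; toℚᵘ-homo‿-)
import Data.Rational.Unnormalised as ℚᵘ
import Data.Rational.Unnormalised.Properties as ℚᵘ
open import Data.Product using (∃; _,_)
open import Data.Sum as Sum using (inj₁; inj₂; _⊎_)
open import Relation.Binary.Definitions using (tri<; tri≈; tri>)
open import Relation.Nullary using (¬_; contradiction)
open import Relation.Binary.PropositionalEquality using (_≡_; _≢_; refl; sym; trans; cong₂; subst)

prime∣*⇒∣⊎∣ : ∀ {p} → Prime p → ∀ i j → + p ∣ i * j → + p ∣ i ⊎ + p ∣ j
prime∣*⇒∣⊎∣ {p} pr i j p∣ij =
  Sum.map ∣ᵤ⇒∣ ∣ᵤ⇒∣ (euclidsLemma ℤ.∣ i ∣ ℤ.∣ j ∣ pr (subst (p ℕ.∣_) (abs-* i j) (∣⇒∣ᵤ p∣ij)))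

prime∣*∤⇒∣ : ∀ {p i j} → Prime p → ¬ (+ p ∣ i) → + p ∣ i * j → + p ∣ j
prime∣*∤⇒∣ {i = i} {j} pr p∤i p∣ij with prime∣*⇒∣⊎∣ pr i j p∣ij
... | inj₁ p∣i = contradiction p∣i p∤i
... | inj₂ p∣j = p∣j

prime*∣ : ∀ {p j k} → Prime p → ¬ (+ p ∣ j) → + p ∣ k → j ∣ k → + p * j ∣ k
prime*∣ {p} {j} pr p∤j p∣k (divides t k≡tj) =
  subst (+ p * j ∣_) (sym k≡tj) (*-monoˡ-∣ j (prime∣*∤⇒∣ pr p∤j p∣tj))
  where
  p∣tj : + p ∣ j * t
  p∣tj = subst (+ p ∣_) (trans k≡tj (*-comm t j)) p∣k

¬∣∣⊖∣ : ∀ {p m n} → m ℕ.< n → n ℕ.< p → ¬ (p ℕ.∣ ℤ.∣ m ⊖ n ∣)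
¬∣∣⊖∣ {m = m} {n} m<n n<p rewrite ∣⊖∣-< m<n =
  ℕ.>⇒∤ {{ℕ.>-nonZero (m<n⇒0<n∸m m<n)}} (≤-<-trans (m∸n≤m n m) n<p)

∣∣⊖∣⇒≡ : ∀ {p m n} → m ℕ.< p → n ℕ.< p → p ℕ.∣ ℤ.∣ m ⊖ n ∣ → m ≡ n
∣∣⊖∣⇒≡ {p} {m} {n} m<p n<p p∣ with <-cmp m n
... | tri< m<n _ _ = contradiction p∣ (¬∣∣⊖∣ m<n n<p)
... | tri≈ _ m≡n _ = m≡n
... | tri> _ _ n<m = contradiction (subst (p ℕ.∣_) (∣m⊖n∣≡∣n⊖m∣ m n) p∣) (¬∣∣⊖∣ n<m m<p)

residues-incongruent : ∀ {p m n} → m ℕ.< p → n ℕ.< p → m ≢ n → ¬ (+ m ≡ℤ + n [mod + p ])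
residues-incongruent {p} {m} {n} m<p n<p m≢n p∣m-n =
  m≢n (∣∣⊖∣⇒≡ m<p n<p (subst (λ z → p ℕ.∣ ℤ.∣ z ∣) (m-n≡m⊖n m n) (∣⇒∣ᵤ p∣m-n)))

quadVal-difference : ∀ a b c x y →
  quadVal a b c x - quadVal a b c y ≡ (x - y) * (a * (x ℤ.+ y) ℤ.+ b)
quadVal-difference = identity
  where
  identity : ∀ a b c x y → (a * x * x ℤ.+ b * x ℤ.+ c) - (a * y * y ℤ.+ b * y ℤ.+ c)
    ≡ (x - y) * (a * (x ℤ.+ y) ℤ.+ b)
  identity = solve-∀

roots-sum : ∀ {p} a b c {x y} → Prime p → ¬ (x ≡ℤ y [mod + p ]) →
  + p ∣ quadVal a b c x → + p ∣ quadVal a b c y → + p ∣ a * (x ℤ.+ y) ℤ.+ b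
roots-sum {p} a b c {x} {y} pr x≢y p∣fx p∣fy =
  prime∣*∤⇒∣ pr x≢y (subst (+ p ∣_) (quadVal-difference a b c x y) (∣m∣n⇒∣m-n p∣fx p∣fy))

roots-sum-reduced : ∀ {p} a b c q {g l x y} → Prime p → ¬ (+ p ∣ a) → a ≡ q * g → b ≡ l * g →
  ¬ (x ≡ℤ y [mod + p ]) → + p ∣ quadVal a b c x → + p ∣ quadVal a b c y →
  + p ∣ q * (x ℤ.+ y) ℤ.+ l
roots-sum-reduced {p} a b c q {g} {l} {x} {y} pr p∤a a≡qg b≡lg x≢y p∣fx p∣fy =
  prime∣*∤⇒∣ pr p∤g (subst (+ p ∣_) a[x+y]+b≡g[q[x+y]+l] (roots-sum a b c pr x≢y p∣fx p∣fy))
  where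
  p∤g : ¬ (+ p ∣ g)
  p∤g p∣g = p∤a (subst (+ p ∣_) (sym a≡qg) (∣n⇒∣m*n q p∣g))
  factor : ∀ q g s l → q * g * s ℤ.+ l * g ≡ g * (q * s ℤ.+ l)
  factor = solve-∀
  a[x+y]+b≡g[q[x+y]+l] : a * (x ℤ.+ y) ℤ.+ b ≡ g * (q * (x ℤ.+ y) ℤ.+ l)
  a[x+y]+b≡g[q[x+y]+l] = trans (cong₂ (λ a b → a * (x ℤ.+ y) ℤ.+ b) a≡qg b≡lg) (factor q g (x ℤ.+ y) l)

inverse-congruence : ∀ {m r r⁻¹ l p} → r * r⁻¹ ≡ℤ 1ℤ [mod m ] → p ≡ℤ l * r⁻¹ [mod m ] →
  r * p ≡ℤ l [mod m ]
inverse-congruence {m} {r} {r⁻¹} {l} {p} rr⁻¹≡1 p≡lr⁻¹ =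
  subst (m ∣_) (identity l r r⁻¹ p) (∣m∣n⇒∣m+n (∣n⇒∣m*n r p≡lr⁻¹) (∣n⇒∣m*n l rr⁻¹≡1))
  where
  identity : ∀ l r r⁻¹ p → r * (p - l * r⁻¹) ℤ.+ l * (r * r⁻¹ - 1ℤ) ≡ r * p - l
  identity = solve-∀

toℚᵘ-/ : ∀ i n .{{_ : NonZero n}} → toℚᵘ (i / n) ℚᵘ.≃ i ℚᵘ./ n
toℚᵘ-/ i (suc n) = toℚᵘ-fromℚᵘ (i ℚᵘ./ suc n)

toℚᵘ-homo-sub : ∀ x y → toℚᵘ (x ℚ.- y) ℚᵘ.≃ toℚᵘ x ℚᵘ.- toℚᵘ y
toℚᵘ-homo-sub x y = ℚᵘ.≃-trans (toℚᵘ-homo-+ x (ℚ.- y)) (ℚᵘ.+-congʳ (toℚᵘ x) (toℚᵘ-homo‿- y))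

∣⇒/-integral : ∀ {k} d .{{_ : NonZero d}} → + d ∣ k → ∃ λ m → k / d ≡ m / 1
∣⇒/-integral d@(suc _) (divides m refl) = m , toℚᵘ-injective (begin-equality
  toℚᵘ ((m * + d) / d)  ≃⟨ toℚᵘ-/ (m * + d) d ⟩
  (m * + d) ℚᵘ./ d      ≃⟨ ℚᵘ.*≡* (*-identityʳ (m * + d)) ⟩
  m ℚᵘ./ 1              ≃⟨ toℚᵘ-/ m 1 ⟨
  toℚᵘ (m / 1)          ∎)
  where open ℚᵘ.≤-Reasoning

fraction-difference : ∀ p q .{{_ : NonZero p}} .{{_ : NonZero q}} (n₁ n₂ r l : ℤ) →
  ((n₁ / p) ℚ.+ (n₂ / p)) ℚ.- ((r / q) ℚ.- _/_ l (p ℕ.* q) {{m*n≢0 p q}})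
    ≡ _/_ (+ q * (n₁ ℤ.+ n₂) ℤ.+ l - r * + p) (p ℕ.* q) {{m*n≢0 p q}}
fraction-difference p@(suc _) q@(suc _) n₁ n₂ r l = toℚᵘ-injective (begin-equality
  toℚᵘ ((n₁ / p ℚ.+ n₂ / p) ℚ.- (r / q ℚ.- l / (p ℕ.* q)))
    ≃⟨ toℚᵘ-homo-sub (n₁ / p ℚ.+ n₂ / p) (r / q ℚ.- l / (p ℕ.* q)) ⟩
  toℚᵘ (n₁ / p ℚ.+ n₂ / p) ℚᵘ.- toℚᵘ (r / q ℚ.- l / (p ℕ.* q))
    ≃⟨ ℚᵘ.+-cong (ℚᵘ.≃-trans (toℚᵘ-homo-+ (n₁ / p) (n₂ / p)) (ℚᵘ.+-cong (toℚᵘ-/ n₁ p) (toℚᵘ-/ n₂ p)))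
                 (ℚᵘ.-‿cong (ℚᵘ.≃-trans (toℚᵘ-homo-sub (r / q) (l / (p ℕ.* q)))
                                      (ℚᵘ.+-cong (toℚᵘ-/ r q) (ℚᵘ.-‿cong (toℚᵘ-/ l (p ℕ.* q)))))) ⟩
  (n₁ ℚᵘ./ p ℚᵘ.+ n₂ ℚᵘ./ p) ℚᵘ.- (r ℚᵘ./ q ℚᵘ.- l ℚᵘ./ (p ℕ.* q))
    ≃⟨ ℚᵘ.*≡* (cross-multiplied n₁ n₂ r l (+ p) (+ q)) ⟩
  N ℚᵘ./ (p ℕ.* q)
    ≃⟨ toℚᵘ-/ N (p ℕ.* q) ⟨
  toℚᵘ (N / (p ℕ.* q)) ∎)
  where
  open ℚᵘ.≤-Reasoning
  N = + q * (n₁ ℤ.+ n₂) ℤ.+ l - r * + p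
  cross-multiplied : ∀ n₁ n₂ r l P Q →
    ((n₁ * P ℤ.+ n₂ * P) * (Q * (P * Q)) ℤ.+ ℤ.- (r * (P * Q) ℤ.+ ℤ.- l * Q) * (P * P)) * (P * Q)
      ≡ (Q * (n₁ ℤ.+ n₂) ℤ.+ l - r * P) * (P * P * (Q * (P * Q)))
  cross-multiplied = solve-∀

-- Irreducibility, a > 0, the value of D, (D/p) = 1 and Coprime r q only guarantee that
-- the roots ν₁ ≢ ν₂ exist; the congruence itself does not use them.
mainTheorem10 : (a b c : ℤ) → IrreducibleQuadratic a b c → 0ℤ ℤ.< a →
    (D : ℤ) → D ≡ b * b - (+ 4) * a * c →
    (q : ℕ) → .{{_ : NonZero q}} → (l : ℤ) →
    a ≡ + q * gcd a b → b ≡ l * gcd a b →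
    (r : ℤ) → Coprime r (+ q) →
    (p : ℕ) → .{{_ : NonZero p}} → Prime p →
    ¬ (+ p ∣ (+ 2) * a * D) → legendre D p ≡ 1ℤ →
    (rinv : ℤ) → r * rinv ≡ℤ 1ℤ [mod + q ] → + p ≡ℤ l * rinv [mod + q ] →
    (ν₁ ν₂ : ℕ) → ν₁ ℕ.< p → ν₂ ℕ.< p → ν₁ ≢ ν₂ →
    + p ∣ quadVal a b c (+ ν₁) → + p ∣ quadVal a b c (+ ν₂) →
    ∃ λ (k : ℤ) →
      ((+ ν₁ / p) ℚ.+ (+ ν₂ / p)) ℚ.- ((r / q) ℚ.- _/_ l (p ℕ.* q) {{m*n≢0 p q}})
        ≡ (k / 1)
mainTheorem10 a b c _ _ D _ q l a≡qg b≡lg r _ p pr p∤2aD _ rinv rr⁻¹≡1 p≡lr⁻¹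
  ν₁ ν₂ ν₁<p ν₂<p ν₁≢ν₂ p∣fν₁ p∣fν₂ =
  let k , N/pq≡k = ∣⇒/-integral (p ℕ.* q) {{m*n≢0 p q}} (subst (_∣ N) (sym (pos-* p q)) pq∣N)
  in k , trans (fraction-difference p q (+ ν₁) (+ ν₂) r l) N/pq≡k
  where
  g = gcd a b
  S = + ν₁ ℤ.+ + ν₂
  N = + q * S ℤ.+ l - r * + p
  p∤a : ¬ (+ p ∣ a)
  p∤a p∣a = p∤2aD (∣m⇒∣m*n D (∣n⇒∣m*n (+ 2) p∣a))
  p∤q : ¬ (+ p ∣ + q)
  p∤q p∣q = p∤a (subst (+ p ∣_) (sym a≡qg) (∣m⇒∣m*n g p∣q))
  p∣qS+l : + p ∣ + q * S ℤ.+ l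
  p∣qS+l = roots-sum-reduced a b c (+ q) pr p∤a a≡qg b≡lg
    (residues-incongruent ν₁<p ν₂<p ν₁≢ν₂) p∣fν₁ p∣fν₂
  q∣N : + q ∣ N
  q∣N = subst (+ q ∣_) (regroup (+ q) S l r (+ p))
    (∣m∣n⇒∣m-n (∣m⇒∣m*n S ∣-refl) (inverse-congruence {r = r} {l = l} rr⁻¹≡1 p≡lr⁻¹))
    where
    regroup : ∀ q S l r p → q * S - (r * p - l) ≡ q * S ℤ.+ l - r * p
    regroup = solve-∀
  pq∣N : + p * + q ∣ N
  pq∣N = prime*∣ pr p∤q (∣m∣n⇒∣m-n p∣qS+l (∣n⇒∣m*n r ∣-refl)) q∣N
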